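{- Let $G=(V,E)$ be a finite simple undirected graph, let $W\subseteq V$ be a vertex cover of $G$, and let $S\subseteq V$ be a minimal separator of $G$. Let $(D_1,S,D_2)$ be a partition of $V$ into three sets such that each of $D_1$ and $D_2$ is a union of connected components of $G-S$, and each of $D_1$ and $D_2$ contains some full component associated to $S$. Put $D_1^W=D_1\cap W$ and $D_2^W=D_2\cap W$. Then $$S\setminus W=\{x\in V\setminus W \mid N(x)\cap D_1^W\neq\emptyset \text{ and } N(x)\cap D_2^W\neq\emptyset\}.$$
   Context: $N(x)$ denotes the set of neighbours of a vertex $x$; for $A\subseteq V$, $N(A)=\bigcup_{v\in A}N(v)\setminus A$. A vertex cover is a set $W$ such that every edge has at least one endpoint in $W$. $G-S$ denotes the subgraph induced by $V\setminus S$; a connected component means the vertex set of a maximal connected induced subgraph. For vertices $u,v$, a set $S$ is a $u,v$-separator if $u,v$ lie in different components of $G-S$; it is a minimal $u,v$-separator if it is inclusion-minimal among $u,v$-separators; $S$ is a minimal separator of $G$ if it is a minimal $u,v$-separator for some pair $u,v$. A component $C$ of $G-S$ is a full component associated to $S$ if $N(C)=S$. -}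

module Defs where

open import Level using (0ℓ)
open import Data.Nat using (ℕ)
open import Data.Fin using (Fin)
open import Data.Product using (Σ; _×_; _,_; ∃; ∃-syntax)
open import Data.Sum using (_⊎_)
open import Data.Empty using (⊥)
open import Relation.Nullary using (¬_)
open import Relation.Binary.PropositionalEquality using (_≡_)

record Graph (n : ℕ) : Set₁ where
  field
    Adj   : Fin n → Fin n → Set
    sym   : ∀ {x y} → Adj x y → Adj y x
    irrefl : ∀ {x} → ¬ Adj x x

VSet : ℕ → Set₁
VSet n = Fin n → Set

module _ {n : ℕ} where

  _⊆_ : VSet n → VSet n → Set
  A ⊆ B = ∀ x → A x → B x

  _≐_ : VSet n → VSet n → Set
  A ≐ B = (A ⊆ B) × (B ⊆ A)

  _∩_ : VSet n → VSet n → VSet n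
  (A ∩ B) x = A x × B x

  _∖_ : VSet n → VSet n → VSet n
  (A ∖ B) x = A x × ¬ B x

  Nonempty : VSet n → Set
  Nonempty A = ∃[ x ] A x

  Disjoint : VSet n → VSet n → Set
  Disjoint A B = ∀ x → A x → B x → ⊥

  IsPartition3 : VSet n → VSet n → VSet n → Set
  IsPartition3 A B C =
    (∀ x → A x ⊎ B x ⊎ C x) × Disjoint A B × Disjoint A C × Disjoint B C

module _ {n : ℕ} (G : Graph n) where
  open Graph G

  Nv : Fin n → VSet n
  Nv x y = Adj x y

  N : VSet n → VSet n
  N A y = (∃[ a ] (A a × Adj a y)) × ¬ A y

  IsVertexCover : VSet n → Set
  IsVertexCover W = ∀ x y → Adj x y → W x ⊎ W y

  data PathIn (A : VSet n) : Fin n → Fin n → Set where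
    here : ∀ {x} → A x → PathIn A x x
    step : ∀ {x y z} → A x → Adj x y → PathIn A y z → PathIn A x z

  ConnectedSet : VSet n → Set
  ConnectedSet A = ∀ x y → A x → A y → PathIn A x y

  Rest : VSet n → VSet n
  Rest S x = ¬ S x

  IsComponent : VSet n → VSet n → Set₁
  IsComponent S C =
    C ⊆ Rest S × Nonempty C × ConnectedSet C ×
    (∀ (D : VSet n) → C ⊆ D → D ⊆ Rest S → ConnectedSet D → D ⊆ C)

  SameComponent : VSet n → Fin n → Fin n → Set₁
  SameComponent S u v = Σ (VSet n) λ C → IsComponent S C × C u × C v

  IsSeparator : VSet n → Fin n → Fin n → Set₁
  IsSeparator S u v = ¬ S u × ¬ S v × ¬ SameComponent S u v

  IsMinimalSeparatorFor : VSet n → Fin n → Fin n → Set₁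
  IsMinimalSeparatorFor S u v =
    IsSeparator S u v ×
    (∀ (S' : VSet n) → S' ⊆ S → ¬ (S ⊆ S') → ¬ IsSeparator S' u v)

  IsMinimalSeparator : VSet n → Set₁
  IsMinimalSeparator S = ∃[ u ] ∃[ v ] IsMinimalSeparatorFor S u v

  IsFullComponent : VSet n → VSet n → Set₁
  IsFullComponent S C = IsComponent S C × (N C ≐ S)

  IsUnionOfComponents : VSet n → VSet n → Set₁
  IsUnionOfComponents S D =
    D ⊆ Rest S × (∀ C → IsComponent S C → Nonempty (C ∩ D) → C ⊆ D)

-- The inclusion ⊆ only needs full components: a vertex x of S outside W has a
-- neighbour in each full component, and that neighbour lies in W because W is a
-- vertex cover. For ⊇, a vertex outside S adjacent to D₁ lies in the component of
-- its neighbour, hence in D₁, and symmetrically for D₂; so a vertex outside W with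
-- neighbours in both D₁ and D₂ can only lie in S.
module Submission where

open import Defs
open import Data.Nat using (ℕ)
open import Data.Fin using (Fin)
open import Data.Product using (Σ; _×_; _,_; proj₁)
open import Data.Sum using (inj₁; inj₂)
open import Data.Empty using (⊥-elim)
open import Relation.Nullary using (¬_)

module Walks {n : ℕ} (G : Graph n) where
  open Graph G

  PathIn-first : ∀ {A u v} → PathIn G A u v → A u
  PathIn-first (here a)     = a
  PathIn-first (step a _ _) = a

  PathIn-last : ∀ {A u v} → PathIn G A u v → A v
  PathIn-last (here a)     = a
  PathIn-last (step _ _ p) = PathIn-last p

  snoc : ∀ {A u v w} → PathIn G A u v → Adj v w → A w → PathIn G A u w
  snoc (here a)     e aw = step a e (here aw)
  snoc (step a e p) f aw = step a e (snoc p f aw)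

  _++_ : ∀ {A u v w} → PathIn G A u v → PathIn G A v w → PathIn G A u w
  here _     ++ q = q
  step a e p ++ q = step a e (p ++ q)

  reverse : ∀ {A u v} → PathIn G A u v → PathIn G A v u
  reverse (here a)     = here a
  reverse (step a e p) = snoc (reverse p) (sym e) a

  PathIn-mono : ∀ {A B u v} → A ⊆ B → PathIn G A u v → PathIn G B u v
  PathIn-mono A⊆B (here {x} a)     = here (A⊆B x a)
  PathIn-mono A⊆B (step {x} a e p) = step (A⊆B x a) e (PathIn-mono A⊆B p)

  ReachableFrom : VSet n → Fin n → VSet n
  ReachableFrom A x = PathIn G A x

  PathIn-reachable : ∀ {A x u v} → ReachableFrom A x u → PathIn G A u v →
                     PathIn G (ReachableFrom A x) u v
  PathIn-reachable r (here _)     = here r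
  PathIn-reachable r (step _ e p) =
    step r e (PathIn-reachable (snoc r e (PathIn-first p)) p)

  reachable-connected : ∀ A x → ConnectedSet G (ReachableFrom A x)
  reachable-connected A x u v p q = PathIn-reachable p (reverse p ++ q)

  reachable-isComponent : ∀ S x → ¬ S x →
                          IsComponent G S (ReachableFrom (Rest G S) x)
  reachable-isComponent S x x∉S =
    (λ _ → PathIn-last) , (x , here x∉S) , reachable-connected (Rest G S) x ,
    λ D C⊆D D⊆Rest D-connected y y∈D →
      PathIn-mono D⊆Rest (D-connected x y (C⊆D x (here x∉S)) y∈D)

  unionOfComponents-closed-adj : ∀ {S D x y} → IsUnionOfComponents G S D →
                                 ¬ S x → Adj x y → D y → D x
  unionOfComponents-closed-adj {S} {x = x} {y} (D⊆Rest , D-union) x∉S e y∈D =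
    D-union (ReachableFrom (Rest G S) x) (reachable-isComponent S x x∉S)
      (y , step x∉S e (here (D⊆Rest y y∈D)) , y∈D) x (here x∉S)

  neighbour-in-cover : ∀ {W S C D} → IsVertexCover G W → S ⊆ N G C → C ⊆ D →
                       (S ∖ W) ⊆ (λ x → Nonempty (Nv G x ∩ (D ∩ W)))
  neighbour-in-cover cover S⊆NC C⊆D x (x∈S , x∉W)
    with S⊆NC x x∈S
  ... | (a , a∈C , e) , _ with cover a x e
  ...   | inj₁ a∈W = a , sym e , C⊆D a a∈C , a∈W
  ...   | inj₂ x∈W = ⊥-elim (x∉W x∈W)

lemma1 : ∀ {n : ℕ} (G : Graph n) (W S D₁ D₂ : VSet n) →
    IsVertexCover G W →
    IsMinimalSeparator G S →
    IsPartition3 D₁ S D₂ →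
    IsUnionOfComponents G S D₁ →
    IsUnionOfComponents G S D₂ →
    (Σ (VSet n) λ C → IsFullComponent G S C × C ⊆ D₁) →
    (Σ (VSet n) λ C → IsFullComponent G S C × C ⊆ D₂) →
    (S ∖ W) ≐ (λ x → ¬ W x × Nonempty (Nv G x ∩ (D₁ ∩ W)) × Nonempty (Nv G x ∩ (D₂ ∩ W)))
lemma1 G W S D₁ D₂ cover _ (covers , _ , D₁∩D₂=∅ , _) U₁ U₂
       (C₁ , (_ , _ , S⊆NC₁) , C₁⊆D₁) (C₂ , (_ , _ , S⊆NC₂) , C₂⊆D₂) =
  S∖W⊆ , ⊆S∖W
  where
  open Walks G

  S∖W⊆ : (S ∖ W) ⊆ _
  S∖W⊆ x x∈S∖W@(_ , x∉W) =
    x∉W , neighbour-in-cover cover S⊆NC₁ C₁⊆D₁ x x∈S∖W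
        , neighbour-in-cover cover S⊆NC₂ C₂⊆D₂ x x∈S∖W

  ⊆S∖W : _ ⊆ (S ∖ W)
  ⊆S∖W x (x∉W , (a , xa , a∈D₁ , _) , (b , xb , b∈D₂ , _)) with covers x
  ... | inj₂ (inj₁ x∈S) = x∈S , x∉W
  ... | inj₁ x∈D₁ =
    ⊥-elim (D₁∩D₂=∅ x x∈D₁
      (unionOfComponents-closed-adj U₂ (proj₁ U₁ x x∈D₁) xb b∈D₂))
  ... | inj₂ (inj₂ x∈D₂) =
    ⊥-elim (D₁∩D₂=∅ x
      (unionOfComponents-closed-adj U₁ (proj₁ U₂ x x∈D₂) xa a∈D₁) x∈D₂)
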